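{- Let $5 \le p \le q \le \binom{p+1}{\lfloor \frac{p+1}{2} \rfloor} - 1$. Then $f(K(3,p,q)) = 2$.
   Context: $K(3,p,q)$ is the complete tripartite graph with parts of sizes $3$, $p$, $q$. A strong orientation of a graph is an orientation of all edges making the digraph strongly connected; the diameter of a strongly connected digraph is the maximum directed distance between ordered pairs of vertices. The oriented diameter $f(G)$ is the minimum diameter over all strong orientations of $G$. -}

module Defs where

open import Data.Nat using (ℕ; zero; suc; _≤_)
open import Data.Fin using (Fin)
open import Data.Bool using (Bool; true; false)
open import Data.Product using (Σ; ∃; _×_; _,_)
open import Relation.Binary.PropositionalEquality using (_≡_; _≢_)
open import Relation.Nullary using (¬_)

record Graph : Set₁ where
  field
    V   : Set
    Adj : V → V → Set

open Graph public

-- Complete tripartite graph K(a,b,c): vertices are (part, index in that part),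
-- two vertices adjacent iff they lie in different parts.
partSize : ℕ → ℕ → ℕ → Fin 3 → ℕ
partSize a b c Fin.zero = a
partSize a b c (Fin.suc Fin.zero) = b
partSize a b c (Fin.suc (Fin.suc Fin.zero)) = c

K3 : ℕ → ℕ → ℕ → Graph
K3 a b c = record
  { V   = Σ (Fin 3) (λ i → Fin (partSize a b c i))
  ; Adj = λ u v → Σ.proj₁ u ≢ Σ.proj₁ v
  }
  where open import Data.Product using (module Σ)

-- An orientation of G: a choice of arcs o u v (u → v) such that arcs only go
-- along edges, and every edge {u,v} receives exactly one direction.
record Orientation (G : Graph) : Set where
  field
    arc      : V G → V G → Bool
    arc-edge : ∀ u v → arc u v ≡ true → Adj G u v
    one-dir  : ∀ u v → Adj G u v → arc u v ≢ arc v u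

open Orientation public

data Walk {G : Graph} (o : Orientation G) : V G → V G → ℕ → Set where
  here : ∀ {u} → Walk o u u zero
  step : ∀ {u v w k} → arc o u v ≡ true → Walk o v w k → Walk o u w (suc k)

DistLe : {G : Graph} → Orientation G → V G → V G → ℕ → Set
DistLe o u v d = ∃ λ k → k ≤ d × Walk o u v k

Strong : {G : Graph} → Orientation G → Set
Strong {G} o = ∀ (u v : V G) → ∃ λ k → Walk o u v k

DiamLe : {G : Graph} → Orientation G → ℕ → Set
DiamLe {G} o d = ∀ (u v : V G) → DistLe o u v d

HasDiameter : {G : Graph} → Orientation G → ℕ → Set
HasDiameter o d = DiamLe o d × (∀ d' → DiamLe o d' → d ≤ d')

OrientedDiameter : Graph → ℕ → Set
OrientedDiameter G d =
  (∃ λ (o : Orientation G) → Strong o × HasDiameter o d)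
  × (∀ (o : Orientation G) → Strong o → ∀ d' → HasDiameter o d' → d ≤ d')

-- Write n = p + 1 and k = ⌊n/2⌋, and let x₁ play the role of an extra vertex of Y, so
-- that Y ∪ {x₁} is indexed by Fin n with x₁ at 0. Orient x₂ → Y → x₃ → Z → x₂, let
-- x₁ → y exactly for y in W = {0, …, k-1}, and give each z ∈ Z a k-subset S z of Fin n
-- with z → g exactly for g ∈ S z. If W and the S z are distinct k-sets, and every pair
-- g ≠ h except those with g ∉ W ∋ h (which pass through x₁) is separated by some S z
-- containing h but not g, then all ordered pairs are at distance at most 2. The n - 1
-- cyclic intervals of length k other than W separate, because 2k ≤ n; the remaining
-- q - p vertices of Z receive further k-subsets, which exist since q < C(n, k). Finally
-- x₂ and x₃ are not adjacent, so no orientation has diameter below 2.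
module Submission where

open import Defs
open import Data.Nat using (ℕ; zero; suc; _+_; _*_; _∸_; _≤_; _<_; _≤?_; _<?_; z≤n; s≤s; s≤s⁻¹)
open import Data.Nat.Properties
open import Data.Nat.DivMod using (_/_; m/n*n≤m; /-monoˡ-≤)
open import Data.Nat.Combinatorics using (_C_; nCk+nC[k+1]≡[n+1]C[k+1])
open import Data.Bool using (Bool; true; false; not)
import Data.Bool.Properties as Bool
open import Data.Fin using (Fin; zero; suc; toℕ; fromℕ<; _↑ˡ_; splitAt; join; inject≤)
import Data.Fin.Properties as Fin
open import Data.Fin.Patterns using (0F; 1F; 2F)
open import Data.Fin.Subset using (Subset; inside; outside; _∈_; _∉_; ∣_∣; ∁; ⊥; Nonempty)
open import Data.Fin.Subset.Properties
  using (_∈?_; drop-there; ∉⊥; ∣⊥∣≡0; x∈∁p⇒x∉p; x∉p⇒x∈∁p; ∣∁p∣≡n∸∣p∣)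
open import Data.Vec using ([]; _∷_; here; there)
import Data.Vec.Properties as Vec
open import Data.List using (List; []; _∷_; _++_; map; filter; length; lookup; tabulate)
open import Data.List.Properties using (length-++; length-map; length-tabulate; filter-all)
open import Data.List.Membership.Propositional using () renaming (_∈_ to _∈ₗ_; _∉_ to _∉ₗ_)
open import Data.List.Membership.Propositional.Properties
  using (∈-map⁻; ∈-filter⁻; ∈-lookup; ∈-tabulate⁺)
open import Data.List.Relation.Unary.All as All using (All; []; _∷_)
import Data.List.Relation.Unary.All.Properties as All
open import Data.List.Relation.Unary.AllPairs using ([]; _∷_)
open import Data.List.Relation.Unary.Any using (here; there)
open import Data.List.Relation.Unary.Unique.Propositional using (Unique)
import Data.List.Relation.Unary.Unique.Propositional.Properties as Unique
open import Data.Product using (∃; _×_; _,_; proj₁; proj₂)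
open import Data.Sum using (_⊎_; inj₁; inj₂; [_,_])
open import Data.Empty using (⊥-elim)
open import Function using (_∘_)
open import Function.Definitions using (Injective)
open import Relation.Nullary using (¬_; Dec; yes; no; ¬?; does; contradiction)
open import Relation.Nullary.Decidable using (dec-true; dec-false)
open import Relation.Binary.Definitions using (DecidableEquality; tri<; tri≈; tri>)
open import Relation.Binary.PropositionalEquality
  using (_≡_; _≢_; refl; sym; trans; cong; cong₂; subst; module ≡-Reasoning)

nonadjacent⇒2≤dist : ∀ {G : Graph} (o : Orientation G) {u v d} →
                     u ≢ v → ¬ Adj G u v → DistLe o u v d → 2 ≤ d
nonadjacent⇒2≤dist o u≢v _   (0 , _ , here)           = ⊥-elim (u≢v refl)
nonadjacent⇒2≤dist o _   ¬uv (1 , _ , step uv here)   = ⊥-elim (¬uv (arc-edge o _ _ uv))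
nonadjacent⇒2≤dist o _   _   (suc (suc _) , ℓ≤d , _) = ≤-trans (s≤s (s≤s z≤n)) ℓ≤d

orientedDiameter≡2 : ∀ {G : Graph} (o : Orientation G) → DiamLe o 2 →
                     (u v : V G) → u ≢ v → ¬ Adj G u v → OrientedDiameter G 2
orientedDiameter≡2 o diam u v u≢v ¬uv =
  (o , strong , diam , atLeast2 o) , λ o′ _ d (diam′ , _) → atLeast2 o′ d diam′
  where
  atLeast2 : ∀ o′ d → DiamLe o′ d → 2 ≤ d
  atLeast2 o′ d diam′ = nonadjacent⇒2≤dist o′ u≢v ¬uv (diam′ u v)
  strong : Strong o
  strong a b = let (ℓ , _ , walk) = diam a b in ℓ , walk

0<∣p∣⇒Nonempty : ∀ {n} (P : Subset n) → 0 < ∣ P ∣ → Nonempty P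
0<∣p∣⇒Nonempty (inside  ∷ P) _     = zero , here
0<∣p∣⇒Nonempty (outside ∷ P) 0<∣P∣ =
  let (x , x∈P) = 0<∣p∣⇒Nonempty P 0<∣P∣ in suc x , there x∈P

another-member : ∀ {n} (P : Subset n) → 2 ≤ ∣ P ∣ → ∀ x → ∃ λ y → y ∈ P × y ≢ x
another-member (inside  ∷ P) _     (suc x) = zero , here , λ ()
another-member (inside  ∷ P) 2≤∣P∣ zero    =
  let (y , y∈P) = 0<∣p∣⇒Nonempty P (s≤s⁻¹ 2≤∣P∣) in suc y , there y∈P , λ ()
another-member (outside ∷ P) 2≤∣P∣ zero    =
  let (y , y∈P) = 0<∣p∣⇒Nonempty P (≤-trans (s≤s z≤n) 2≤∣P∣) in suc y , there y∈P , λ ()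
another-member (outside ∷ P) 2≤∣P∣ (suc x) =
  let (y , y∈P , y≢x) = another-member P 2≤∣P∣ x in suc y , there y∈P , y≢x ∘ Fin.suc-injective

suc-member : ∀ {n} (P : Subset (suc n)) → 2 ≤ ∣ P ∣ → ∃ λ i → suc i ∈ P
suc-member P 2≤∣P∣ with another-member P 2≤∣P∣ zero
... | suc i , i+1∈P , _   = i , i+1∈P
... | zero  , _     , 0≢0 = contradiction refl 0≢0

suc-nonmember : ∀ {n} (P : Subset (suc n)) → 2 ≤ ∣ ∁ P ∣ → ∃ λ i → suc i ∉ P
suc-nonmember P 2≤∣∁P∣ = let (i , i+1∈∁P) = suc-member (∁ P) 2≤∣∁P∣ in i , x∈∁p⇒x∉p i+1∈∁P

member-outside-∷ : ∀ {n} {P Q : Subset n} {s t} →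
                   (∃ λ x → x ∈ P × x ∉ Q) → ∃ λ x → x ∈ s ∷ P × x ∉ t ∷ Q
member-outside-∷ (x , x∈P , x∉Q) = suc x , there x∈P , x∉Q ∘ drop-there

member-outside : ∀ {n} (P Q : Subset n) → ∣ Q ∣ ≤ ∣ P ∣ → P ≢ Q → ∃ λ x → x ∈ P × x ∉ Q
member-outside []            []            _   P≢Q = contradiction refl P≢Q
member-outside (inside  ∷ P) (outside ∷ Q) _   _   = zero , here , λ ()
member-outside (inside  ∷ P) (inside  ∷ Q) Q≤P P≢Q =
  member-outside-∷ (member-outside P Q (s≤s⁻¹ Q≤P) (P≢Q ∘ cong (inside ∷_)))
member-outside (outside ∷ P) (outside ∷ Q) Q≤P P≢Q =
  member-outside-∷ (member-outside P Q Q≤P (P≢Q ∘ cong (outside ∷_)))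
member-outside (outside ∷ P) (inside  ∷ Q) Q<P _   =
  member-outside-∷ (member-outside P Q (<⇒≤ Q<P) (λ P≡Q → <-irrefl (cong ∣_∣ (sym P≡Q)) Q<P))

module OrientationFromFamily {p q : ℕ} (W : Subset (suc p)) (S : Fin q → Subset (suc p)) where

  pattern x₁  = (0F , 0F)
  pattern x₂  = (0F , 1F)
  pattern x₃  = (0F , 2F)
  pattern y i = (1F , i)
  pattern z j = (2F , j)

  Vertex : Set
  Vertex = V (K3 3 p q)

  y⁺ : Fin (suc p) → Vertex
  y⁺ zero    = x₁
  y⁺ (suc i) = y i

  arcXY : Fin 3 → Fin p → Bool
  arcXY 0F i = does (suc i ∈? W)
  arcXY 1F _ = true
  arcXY 2F _ = false

  arcZX : Fin q → Fin 3 → Bool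
  arcZX j 0F = does (zero ∈? S j)
  arcZX _ 1F = true
  arcZX _ 2F = false

  arcZY : Fin q → Fin p → Bool
  arcZY j i = does (suc i ∈? S j)

  arcs : Vertex → Vertex → Bool
  arcs (0F , x) (1F , i) = arcXY x i
  arcs (1F , i) (0F , x) = not (arcXY x i)
  arcs (2F , j) (0F , x) = arcZX j x
  arcs (0F , x) (2F , j) = not (arcZX j x)
  arcs (2F , j) (1F , i) = arcZY j i
  arcs (1F , i) (2F , j) = not (arcZY j i)
  arcs (0F , _) (0F , _) = false
  arcs (1F , _) (1F , _) = false
  arcs (2F , _) (2F , _) = false

  arcs-between-parts : ∀ u v → arcs u v ≡ true → Adj (K3 3 p q) u v
  arcs-between-parts (0F , _) (0F , _) ()
  arcs-between-parts (1F , _) (1F , _) ()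
  arcs-between-parts (2F , _) (2F , _) ()
  arcs-between-parts (0F , _) (1F , _) _ ()
  arcs-between-parts (0F , _) (2F , _) _ ()
  arcs-between-parts (1F , _) (0F , _) _ ()
  arcs-between-parts (1F , _) (2F , _) _ ()
  arcs-between-parts (2F , _) (0F , _) _ ()
  arcs-between-parts (2F , _) (1F , _) _ ()

  arcs-one-way : ∀ u v → Adj (K3 3 p q) u v → arcs u v ≢ arcs v u
  arcs-one-way (0F , _) (0F , _) adj = contradiction refl adj
  arcs-one-way (1F , _) (1F , _) adj = contradiction refl adj
  arcs-one-way (2F , _) (2F , _) adj = contradiction refl adj
  arcs-one-way (0F , _) (1F , _) _   = Bool.not-¬ refl
  arcs-one-way (1F , _) (0F , _) _   = Bool.not-¬ refl ∘ sym
  arcs-one-way (2F , _) (0F , _) _   = Bool.not-¬ refl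
  arcs-one-way (0F , _) (2F , _) _   = Bool.not-¬ refl ∘ sym
  arcs-one-way (2F , _) (1F , _) _   = Bool.not-¬ refl
  arcs-one-way (1F , _) (2F , _) _   = Bool.not-¬ refl ∘ sym

  orientation : Orientation (K3 3 p q)
  orientation = record { arc = arcs ; arc-edge = arcs-between-parts ; one-dir = arcs-one-way }

  z→y⁺ : ∀ {j g} → g ∈ S j → arcs (z j) (y⁺ g) ≡ true
  z→y⁺ {j} {zero}  g∈Sj = dec-true (zero ∈? S j) g∈Sj
  z→y⁺ {j} {suc i} g∈Sj = dec-true (suc i ∈? S j) g∈Sj

  y⁺→z : ∀ {j g} → g ∉ S j → arcs (y⁺ g) (z j) ≡ true
  y⁺→z {j} {zero}  g∉Sj = cong not (dec-false (zero ∈? S j) g∉Sj)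
  y⁺→z {j} {suc i} g∉Sj = cong not (dec-false (suc i ∈? S j) g∉Sj)

  x₁→y : ∀ {i} → suc i ∈ W → arcs x₁ (y i) ≡ true
  x₁→y {i} i+1∈W = dec-true (suc i ∈? W) i+1∈W

  y→x₁ : ∀ {i} → suc i ∉ W → arcs (y i) x₁ ≡ true
  y→x₁ {i} i+1∉W = cong not (dec-false (suc i ∈? W) i+1∉W)

  Near : Vertex → Vertex → Set
  Near u v = DistLe orientation u v 2

  stay : ∀ {u} → Near u u
  stay = 0 , z≤n , here

  hop : ∀ {u v} → arcs u v ≡ true → Near u v
  hop uv = 1 , s≤s z≤n , step uv here

  via : ∀ {u v} w → arcs u w ≡ true → arcs w v ≡ true → Near u v
  via w uw wv = 2 , ≤-refl , step uw (step wv here)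

  data VertexView : Vertex → Set where
    at-y⁺ : ∀ g → VertexView (y⁺ g)
    at-x₂ : VertexView x₂
    at-x₃ : VertexView x₃
    at-z  : ∀ j → VertexView (z j)

  view : ∀ v → VertexView v
  view x₁    = at-y⁺ zero
  view x₂    = at-x₂
  view x₃    = at-x₃
  view (y i) = at-y⁺ (suc i)
  view (z j) = at-z j

  module _ {k : ℕ} (2≤k : 2 ≤ k) (2+k≤n : 2 + k ≤ suc p)
           (∣W∣≡k : ∣ W ∣ ≡ k) (∣S∣≡k : ∀ j → ∣ S j ∣ ≡ k)
           (S-injective : Injective _≡_ _≡_ S) (S≢W : ∀ j → S j ≢ W)
           (separating : ∀ g h → g ≢ h → (h ∈ W → g ∈ W) → ∃ λ j → g ∉ S j × h ∈ S j) where

    private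
      k-set-bounds : ∀ P → ∣ P ∣ ≡ k → 2 ≤ ∣ P ∣ × 2 ≤ ∣ ∁ P ∣
      k-set-bounds P ∣P∣≡k =
        subst (2 ≤_) (sym ∣P∣≡k) 2≤k ,
        subst (2 ≤_) (sym (trans (∣∁p∣≡n∸∣p∣ P) (cong (suc p ∸_) ∣P∣≡k))) (m+n≤o⇒m≤o∸n 2 2+k≤n)

      2≤∣W∣ : 2 ≤ ∣ W ∣
      2≤∣W∣ = proj₁ (k-set-bounds W ∣W∣≡k)

      2≤∣∁W∣ : 2 ≤ ∣ ∁ W ∣
      2≤∣∁W∣ = proj₂ (k-set-bounds W ∣W∣≡k)

      2≤∣S∣ : ∀ j → 2 ≤ ∣ S j ∣
      2≤∣S∣ j = proj₁ (k-set-bounds (S j) (∣S∣≡k j))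

      2≤∣∁S∣ : ∀ j → 2 ≤ ∣ ∁ (S j) ∣
      2≤∣∁S∣ j = proj₂ (k-set-bounds (S j) (∣S∣≡k j))

    covered : ∀ h → ∃ λ j → h ∈ S j
    covered h =
      let (g , g∈W , g≢h) = another-member W 2≤∣W∣ h
          (j , _ , h∈Sj)  = separating g h g≢h (λ _ → g∈W)
      in j , h∈Sj

    uncovered : ∀ g → ∃ λ j → g ∉ S j
    uncovered g with g ∈? W
    ... | yes g∈W = let (h , _ , h≢g)   = another-member W 2≤∣W∣ g
                        (j , g∉Sj , _) = separating g h (h≢g ∘ sym) (λ _ → g∈W)
                    in j , g∉Sj
    ... | no  g∉W = let (h , h∈∁W , h≢g) = another-member (∁ W) 2≤∣∁W∣ g
                        (j , g∉Sj , _)   = separating g h (h≢g ∘ sym)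
                                             (λ h∈W → contradiction h∈W (x∈∁p⇒x∉p h∈∁W))
                    in j , g∉Sj

    through-z : ∀ g h → g ≢ h → (h ∈ W → g ∈ W) → Near (y⁺ g) (y⁺ h)
    through-z g h g≢h h∈W⇒g∈W =
      let (j , g∉Sj , h∈Sj) = separating g h g≢h h∈W⇒g∈W in via (z j) (y⁺→z g∉Sj) (z→y⁺ h∈Sj)

    through-x₁ : ∀ g h → g ∉ W → h ∈ W → Near (y⁺ g) (y⁺ h)
    through-x₁ zero    zero    g∉W h∈W = contradiction h∈W g∉W
    through-x₁ zero    (suc _) _   h∈W = hop (x₁→y h∈W)
    through-x₁ (suc _) zero    g∉W _   = hop (y→x₁ g∉W)
    through-x₁ (suc _) (suc _) g∉W h∈W = via x₁ (y→x₁ g∉W) (x₁→y h∈W)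

    y⁺⇝y⁺ : ∀ g h → Near (y⁺ g) (y⁺ h)
    y⁺⇝y⁺ g h with g Fin.≟ h
    ... | yes refl = stay
    ... | no g≢h with g ∈? W | h ∈? W
    ...   | no  g∉W | yes h∈W = through-x₁ g h g∉W h∈W
    ...   | yes g∈W | _       = through-z g h g≢h (λ _ → g∈W)
    ...   | no  _   | no  h∉W = through-z g h g≢h (λ h∈W → contradiction h∈W h∉W)

    y⁺⇝z : ∀ g j → Near (y⁺ g) (z j)
    y⁺⇝z g j with g ∈? S j
    ... | no  g∉Sj = hop (y⁺→z g∉Sj)
    y⁺⇝z (suc _) j | yes _ = via x₃ refl refl
    y⁺⇝z zero    j | yes 0∈Sj
      with member-outside W (S j) (≤-reflexive (trans (∣S∣≡k j) (sym ∣W∣≡k))) (S≢W j ∘ sym)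
    ... | suc i , i+1∈W , i+1∉Sj = via (y i) (x₁→y i+1∈W) (y⁺→z i+1∉Sj)
    ... | zero  , _     , 0∉Sj   = contradiction 0∈Sj 0∉Sj

    z⇝y⁺ : ∀ j g → Near (z j) (y⁺ g)
    z⇝y⁺ j g with g ∈? S j
    ... | yes g∈Sj = hop (z→y⁺ g∈Sj)
    z⇝y⁺ j (suc _) | no _ = via x₂ refl refl
    z⇝y⁺ j zero    | no 0∉Sj
      with member-outside (S j) W (≤-reflexive (trans ∣W∣≡k (sym (∣S∣≡k j)))) (S≢W j)
    ... | suc i , i+1∈Sj , i+1∉W = via (y i) (z→y⁺ i+1∈Sj) (y→x₁ i+1∉W)
    ... | zero  , 0∈Sj   , _     = contradiction 0∈Sj 0∉Sj

    z⇝z : ∀ j j′ → Near (z j) (z j′)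
    z⇝z j j′ with j Fin.≟ j′
    ... | yes refl = stay
    ... | no  j≢j′ =
      let (g , g∈Sj , g∉Sj′) = member-outside (S j) (S j′)
                                 (≤-reflexive (trans (∣S∣≡k j′) (sym (∣S∣≡k j)))) (j≢j′ ∘ S-injective)
      in via (y⁺ g) (z→y⁺ g∈Sj) (y⁺→z g∉Sj′)

    x₂⇝y⁺ : ∀ g → Near x₂ (y⁺ g)
    x₂⇝y⁺ (suc _) = hop refl
    x₂⇝y⁺ zero    = let (i , i+1∉W) = suc-nonmember W 2≤∣∁W∣ in via (y i) refl (y→x₁ i+1∉W)

    y⁺⇝x₃ : ∀ g → Near (y⁺ g) x₃
    y⁺⇝x₃ (suc _) = hop refl
    y⁺⇝x₃ zero    = let (i , i+1∈W) = suc-member W 2≤∣W∣ in via (y i) (x₁→y i+1∈W) refl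

    y⁺⇝x₂ : ∀ g → Near (y⁺ g) x₂
    y⁺⇝x₂ g = let (j , g∉Sj) = uncovered g in via (z j) (y⁺→z g∉Sj) refl

    x₃⇝y⁺ : ∀ g → Near x₃ (y⁺ g)
    x₃⇝y⁺ g = let (j , g∈Sj) = covered g in via (z j) refl (z→y⁺ g∈Sj)

    x₂⇝z : ∀ j → Near x₂ (z j)
    x₂⇝z j = let (i , i+1∉Sj) = suc-nonmember (S j) (2≤∣∁S∣ j) in via (y i) refl (y⁺→z i+1∉Sj)

    z⇝x₃ : ∀ j → Near (z j) x₃
    z⇝x₃ j = let (i , i+1∈Sj) = suc-member (S j) (2≤∣S∣ j) in via (y i) (z→y⁺ i+1∈Sj) refl

    x₂⇝x₃ : Near x₂ x₃
    x₂⇝x₃ = let (i , _) = suc-member W 2≤∣W∣ in via (y i) refl refl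

    x₃⇝x₂ : Near x₃ x₂
    x₃⇝x₂ = let (j , _) = covered zero in via (z j) refl refl

    diameter≤2 : DiamLe orientation 2
    diameter≤2 u v with view u | view v
    ... | at-y⁺ g | at-y⁺ h = y⁺⇝y⁺ g h
    ... | at-y⁺ g | at-x₂   = y⁺⇝x₂ g
    ... | at-y⁺ g | at-x₃   = y⁺⇝x₃ g
    ... | at-y⁺ g | at-z j  = y⁺⇝z g j
    ... | at-x₂   | at-y⁺ h = x₂⇝y⁺ h
    ... | at-x₂   | at-x₂   = stay
    ... | at-x₂   | at-x₃   = x₂⇝x₃
    ... | at-x₂   | at-z j  = x₂⇝z j
    ... | at-x₃   | at-y⁺ h = x₃⇝y⁺ h
    ... | at-x₃   | at-x₂   = x₃⇝x₂
    ... | at-x₃   | at-x₃   = stay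
    ... | at-x₃   | at-z _  = hop refl
    ... | at-z j  | at-y⁺ h = z⇝y⁺ j h
    ... | at-z _  | at-x₂   = hop refl
    ... | at-z j  | at-x₃   = z⇝x₃ j
    ... | at-z j  | at-z j′ = z⇝z j j′

    K3-orientedDiameter≡2 : OrientedDiameter (K3 3 p q) 2
    K3-orientedDiameter≡2 =
      orientedDiameter≡2 orientation diameter≤2 x₂ x₃ (λ ()) (λ x₂~x₃ → x₂~x₃ refl)

lookup-injective : ∀ {A : Set} {xs : List A} → Unique xs → ∀ i j → lookup xs i ≡ lookup xs j → i ≡ j
lookup-injective (_  ∷ _) zero    zero    _ = refl
lookup-injective (x≢ ∷ _) zero    (suc j) e = contradiction e (All.lookup x≢ (∈-lookup j))
lookup-injective (x≢ ∷ _) (suc i) zero    e = contradiction (sym e) (All.lookup x≢ (∈-lookup i))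
lookup-injective (_  ∷ u) (suc i) (suc j) e = cong suc (lookup-injective u i j e)

module Without {A : Set} (_≟_ : DecidableEquality A) where

  _≢?_ : ∀ x y → Dec (x ≢ y)
  x ≢? y = ¬? (x ≟ y)

  remove : A → List A → List A
  remove y = filter (_≢? y)

  _without_ : List A → List A → List A
  xs without []       = xs
  xs without (y ∷ ys) = remove y (xs without ys)

  length-remove : ∀ y {xs} → Unique xs → length xs ≤ suc (length (remove y xs))
  length-remove y {[]}     _            = z≤n
  length-remove y {x ∷ xs} (x≢xs ∷ uniq) with x ≟ y
  ... | yes refl = s≤s (≤-reflexive (cong length (sym (filter-all (_≢? y) (All.map (_∘ sym) x≢xs)))))
  ... | no  _    = s≤s (length-remove y uniq)

  without-unique : ∀ {xs} ys → Unique xs → Unique (xs without ys)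
  without-unique []       uniq = uniq
  without-unique (y ∷ ys) uniq = Unique.filter⁺ (_≢? y) (without-unique ys uniq)

  length-without : ∀ {xs} ys → Unique xs → length xs ≤ length ys + length (xs without ys)
  length-without      []       _    = ≤-refl
  length-without {xs} (y ∷ ys) uniq = begin
    length xs                                            ≤⟨ length-without ys uniq ⟩
    length ys + length (xs without ys)                   ≤⟨ +-monoʳ-≤ (length ys)
                                                              (length-remove y (without-unique ys uniq)) ⟩
    length ys + suc (length (remove y (xs without ys)))  ≡⟨ +-suc (length ys) _ ⟩
    suc (length ys + length (xs without (y ∷ ys)))       ∎
    where open ≤-Reasoning

  ∈-without⁻ : ∀ {x xs} ys → x ∈ₗ xs without ys → x ∈ₗ xs × x ∉ₗ ys
  ∈-without⁻ []       x∈ = x∈ , λ ()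
  ∈-without⁻ (y ∷ ys) x∈ with ∈-filter⁻ (_≢? y) x∈
  ... | x∈′ , x≢y with ∈-without⁻ ys x∈′
  ...   | x∈xs , x∉ys = x∈xs , λ { (here x≡y) → x≢y x≡y ; (there x∈ys) → x∉ys x∈ys }

subsetsOfSize : ∀ n → ℕ → List (Subset n)
subsetsOfSize n       zero    = ⊥ ∷ []
subsetsOfSize zero    (suc k) = []
subsetsOfSize (suc n) (suc k) =
  map (inside ∷_) (subsetsOfSize n k) ++ map (outside ∷_) (subsetsOfSize n (suc k))

length-subsetsOfSize : ∀ n k → length (subsetsOfSize n k) ≡ n C k
length-subsetsOfSize n       zero    = refl
length-subsetsOfSize zero    (suc k) = refl
length-subsetsOfSize (suc n) (suc k) = begin
  length (map (inside ∷_) P₁ ++ map (outside ∷_) P₀)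
    ≡⟨ length-++ (map (inside ∷_) P₁) ⟩
  length (map (inside ∷_) P₁) + length (map (outside ∷_) P₀)
    ≡⟨ cong₂ _+_ (length-map (inside ∷_) P₁) (length-map (outside ∷_) P₀) ⟩
  length P₁ + length P₀
    ≡⟨ cong₂ _+_ (length-subsetsOfSize n k) (length-subsetsOfSize n (suc k)) ⟩
  n C k + n C suc k
    ≡⟨ nCk+nC[k+1]≡[n+1]C[k+1] n k ⟩
  suc n C suc k ∎
  where
  open ≡-Reasoning
  P₁ P₀ : List (Subset n)
  P₁ = subsetsOfSize n k
  P₀ = subsetsOfSize n (suc k)

subsetsOfSize-size : ∀ n k → All (λ P → ∣ P ∣ ≡ k) (subsetsOfSize n k)
subsetsOfSize-size n       zero    = ∣⊥∣≡0 n ∷ []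
subsetsOfSize-size zero    (suc k) = []
subsetsOfSize-size (suc n) (suc k) =
  All.++⁺ (All.map⁺ (All.map (cong suc) (subsetsOfSize-size n k)))
          (All.map⁺ (subsetsOfSize-size n (suc k)))

subsetsOfSize-unique : ∀ n k → Unique (subsetsOfSize n k)
subsetsOfSize-unique n       zero    = [] ∷ []
subsetsOfSize-unique zero    (suc k) = []
subsetsOfSize-unique (suc n) (suc k) =
  Unique.++⁺ (Unique.map⁺ Vec.∷-injectiveʳ (subsetsOfSize-unique n k))
             (Unique.map⁺ Vec.∷-injectiveʳ (subsetsOfSize-unique n (suc k)))
             heads-differ
  where
  heads-differ : ∀ {P} → ¬ (P ∈ₗ map (inside ∷_) (subsetsOfSize n k) ×
                            P ∈ₗ map (outside ∷_) (subsetsOfSize n (suc k)))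
  heads-differ (P∈ , P∈′) with ∈-map⁻ (inside ∷_) P∈ | ∈-map⁻ (outside ∷_) P∈′
  ... | _ , _ , refl | _ , _ , ()

range : ∀ {n} → ℕ → ℕ → Subset n
range {zero}  _       _       = []
range {suc n} _       zero    = ⊥
range {suc n} zero    (suc b) = inside  ∷ range zero b
range {suc n} (suc a) (suc b) = outside ∷ range a b

∈-range⁺ : ∀ {n a b} {x : Fin n} → a ≤ toℕ x → toℕ x < b → x ∈ range a b
∈-range⁺ {a = zero}  {suc b} {zero}  _         _         = here
∈-range⁺ {a = zero}  {suc b} {suc x} _         (s≤s x<b) = there (∈-range⁺ z≤n x<b)
∈-range⁺ {a = suc a} {suc b} {suc x} (s≤s a≤x) (s≤s x<b) = there (∈-range⁺ a≤x x<b)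

∈-range⁻ : ∀ {n a b} {x : Fin n} → x ∈ range a b → a ≤ toℕ x × toℕ x < b
∈-range⁻ {suc n} {b = zero}                  x∈ = contradiction x∈ ∉⊥
∈-range⁻ {suc n} {zero}  {suc b} {zero}  here       = z≤n , s≤s z≤n
∈-range⁻ {suc n} {zero}  {suc b} {suc x} (there x∈) = z≤n , s≤s (proj₂ (∈-range⁻ x∈))
∈-range⁻ {suc n} {suc a} {suc b} {suc x} (there x∈) =
  let (a≤x , x<b) = ∈-range⁻ x∈ in s≤s a≤x , s≤s x<b

∣range∣ : ∀ {n} a b → b ≤ n → ∣ range {n} a b ∣ ≡ b ∸ a
∣range∣ {zero}  a       zero    _         = sym (0∸n≡0 a)
∣range∣ {suc n} a       zero    _         = trans (∣⊥∣≡0 (suc n)) (sym (0∸n≡0 a))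
∣range∣ {suc n} zero    (suc b) (s≤s b≤n) = cong suc (∣range∣ zero b b≤n)
∣range∣ {suc n} (suc a) (suc b) (s≤s b≤n) = ∣range∣ a b b≤n

-- window s is the cyclic interval {s, s + 1, …, s + k - 1} of ℤ/n; in InWindow the
-- second disjunct describes the part that wraps around past n - 1.
module CyclicWindows (p k : ℕ) (1≤k : 1 ≤ k) (k+k≤n : k + k ≤ suc p) where

  private
    n : ℕ
    n = suc p

    k≤n : k ≤ n
    k≤n = ≤-trans (m≤m+n k k) k+k≤n

  InWindow : ℕ → ℕ → Set
  InWindow s x = s ≤ x × x < s + k ⊎ x + n < s + k

  windowOf : ∀ s → Dec (s + k ≤ n) → Subset n
  windowOf s (yes _) = range s (s + k)
  windowOf s (no  _) = ∁ (range (s + k ∸ n) s)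

  window : Fin n → Subset n
  window s = windowOf (toℕ s) (toℕ s + k ≤? n)

  no-wrap-after : ∀ {s x} → s ≤ x → ¬ x + n < s + k
  no-wrap-after s≤x x+n<s+k = <⇒≱ x+n<s+k (+-mono-≤ s≤x k≤n)

  ∈windowOf⁻ : ∀ {s} (d : Dec (s + k ≤ n)) {x : Fin n} → x ∈ windowOf s d → InWindow s (toℕ x)
  ∈windowOf⁻     (yes _)        x∈ = inj₁ (∈-range⁻ x∈)
  ∈windowOf⁻ {s} (no s+k≰n) {x} x∈ with toℕ x <? s
  ... | no  x≮s = inj₁ (≮⇒≥ x≮s , <-trans (Fin.toℕ<n x) (≰⇒> s+k≰n))
  ... | yes x<s = inj₂ (begin-strict
    toℕ x + n       <⟨ +-monoˡ-< n (≰⇒> (λ a≤x → x∈∁p⇒x∉p x∈ (∈-range⁺ a≤x x<s))) ⟩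
    s + k ∸ n + n   ≡⟨ m∸n+n≡m (<⇒≤ (≰⇒> s+k≰n)) ⟩
    s + k           ∎)
    where open ≤-Reasoning

  ∈windowOf⁺ : ∀ {s} (d : Dec (s + k ≤ n)) {x : Fin n} → InWindow s (toℕ x) → x ∈ windowOf s d
  ∈windowOf⁺ (yes _)         (inj₁ (s≤x , x<s+k)) = ∈-range⁺ s≤x x<s+k
  ∈windowOf⁺ (yes s+k≤n) {x} (inj₂ x+n<s+k)       =
    contradiction (≤-trans s+k≤n (m≤n+m n (toℕ x))) (<⇒≱ x+n<s+k)
  ∈windowOf⁺ (no  _)         (inj₁ (s≤x , _))     =
    x∉p⇒x∈∁p (λ x∈ → <⇒≱ (proj₂ (∈-range⁻ x∈)) s≤x)
  ∈windowOf⁺ {s} (no s+k≰n) {x} (inj₂ x+n<s+k)   = x∉p⇒x∈∁p λ x∈ → <⇒≱ x+n<s+k (begin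
    s + k           ≡⟨ m∸n+n≡m (<⇒≤ (≰⇒> s+k≰n)) ⟨
    s + k ∸ n + n   ≤⟨ +-monoˡ-≤ n (proj₁ (∈-range⁻ {b = s} x∈)) ⟩
    toℕ x + n       ∎)
    where open ≤-Reasoning

  ∣windowOf∣ : ∀ {s} → s < n → (d : Dec (s + k ≤ n)) → ∣ windowOf s d ∣ ≡ k
  ∣windowOf∣ {s} _   (yes s+k≤n) = trans (∣range∣ s (s + k) s+k≤n) (m+n∸m≡n s k)
  ∣windowOf∣ {s} s<n (no s+k≰n)  = begin
    ∣ ∁ gap ∣               ≡⟨ ∣∁p∣≡n∸∣p∣ gap ⟩
    n ∸ ∣ gap ∣             ≡⟨ cong (n ∸_) (∣range∣ a s (<⇒≤ s<n)) ⟩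
    n ∸ (s ∸ a)             ≡⟨ cong (λ t → n ∸ (t ∸ a)) a+[n∸k]≡s ⟨
    n ∸ (a + (n ∸ k) ∸ a)   ≡⟨ cong (n ∸_) (m+n∸m≡n a (n ∸ k)) ⟩
    n ∸ (n ∸ k)             ≡⟨ m∸[m∸n]≡n k≤n ⟩
    k                       ∎
    where
    open ≡-Reasoning
    a : ℕ
    a = s + k ∸ n
    gap : Subset n
    gap = range a s
    a+[n∸k]≡s : a + (n ∸ k) ≡ s
    a+[n∸k]≡s = +-cancelʳ-≡ k _ _ (begin
      a + (n ∸ k) + k   ≡⟨ +-assoc a (n ∸ k) k ⟩
      a + (n ∸ k + k)   ≡⟨ cong (a +_) (m∸n+n≡m k≤n) ⟩
      a + n             ≡⟨ m∸n+n≡m (<⇒≤ (≰⇒> s+k≰n)) ⟩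
      s + k             ∎)

  ∈window⁺ : ∀ {s x : Fin n} → InWindow (toℕ s) (toℕ x) → x ∈ window s
  ∈window⁺ {s} = ∈windowOf⁺ (toℕ s + k ≤? n)

  ∈window⁻ : ∀ {s x : Fin n} → x ∈ window s → InWindow (toℕ s) (toℕ x)
  ∈window⁻ {s} = ∈windowOf⁻ (toℕ s + k ≤? n)

  ∣window∣ : ∀ s → ∣ window s ∣ ≡ k
  ∣window∣ s = ∣windowOf∣ (Fin.toℕ<n s) (toℕ s + k ≤? n)

  InWindow-refl : ∀ s → InWindow s s
  InWindow-refl s = inj₁ (≤-refl , m<m+n s 1≤k)

  InWindow-< : ∀ {s t} → s < t → InWindow s t → ¬ InWindow t s
  InWindow-< s<t (inj₂ t+n<s+k) _                = no-wrap-after (<⇒≤ s<t) t+n<s+k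
  InWindow-< s<t _              (inj₁ (t≤s , _)) = <⇒≱ s<t t≤s
  InWindow-< {s} {t} s<t (inj₁ (_ , t<s+k)) (inj₂ s+n<t+k) = <-irrefl refl (begin-strict
    s + n         <⟨ s+n<t+k ⟩
    t + k         <⟨ +-monoˡ-< k t<s+k ⟩
    s + k + k     ≡⟨ +-assoc s k k ⟩
    s + (k + k)   ≤⟨ +-monoʳ-≤ s k+k≤n ⟩
    s + n         ∎)
    where open ≤-Reasoning

  InWindow-antisym : ∀ {s t} → InWindow s t → InWindow t s → s ≡ t
  InWindow-antisym {s} {t} st ts with <-cmp s t
  ... | tri< s<t _ _ = contradiction ts (InWindow-< s<t st)
  ... | tri≈ _ s≡t _ = s≡t
  ... | tri> _ _ t<s = contradiction st (InWindow-< t<s ts)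

  window-injective : ∀ s t → window s ≡ window t → s ≡ t
  window-injective s t ws≡wt = Fin.toℕ-injective (InWindow-antisym
    (∈window⁻ (subst (t ∈_) (sym ws≡wt) (∈window⁺ (InWindow-refl (toℕ t)))))
    (∈window⁻ (subst (s ∈_) ws≡wt (∈window⁺ (InWindow-refl (toℕ s))))))

  Separator : ℕ → ℕ → Set
  Separator x y = ∃ λ s → 0 < s × s < n × InWindow s y × ¬ InWindow s x

  separator-starting-at : ∀ {x y} → 0 < y → y < n → ¬ InWindow y x → Separator x y
  separator-starting-at {y = y} 0<y y<n ¬yx = y , 0<y , y<n , InWindow-refl y , ¬yx

  separator-ending-at : ∀ {x y} → k ≤ y → y < n → ¬ (x ≤ y × y < x + k) → Separator x y
  separator-ending-at {x} {y} k≤y y<n ¬between =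
    s , m<n⇒0<n∸m (s≤s k≤y) , ≤-<-trans s≤y y<n , inj₁ (s≤y , y<s+k) , ¬sx
    where
    s : ℕ
    s = suc y ∸ k
    s+k≡1+y : s + k ≡ suc y
    s+k≡1+y = m∸n+n≡m (≤-trans k≤y (n≤1+n y))
    s≤y : s ≤ y
    s≤y = ∸-monoʳ-≤ (suc y) 1≤k
    y<s+k : y < s + k
    y<s+k = ≤-reflexive (sym s+k≡1+y)
    ¬sx : ¬ InWindow s x
    ¬sx (inj₁ (s≤x , x<s+k)) =
      ¬between (s≤s⁻¹ (subst (x <_) s+k≡1+y x<s+k) , subst (_≤ x + k) s+k≡1+y (+-monoˡ-≤ k s≤x))
    ¬sx (inj₂ x+n<s+k) =
      <⇒≱ y<n (≤-trans (m≤n+m n x) (s≤s⁻¹ (subst (x + n <_) s+k≡1+y x+n<s+k)))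

  separator-wrapping-to : ∀ {x y} → y < x → x < k → Separator x y
  separator-wrapping-to {x} {y} y<x x<k = s , s≤s z≤n , s<n , inj₂ y+n<s+k , ¬sx
    where
    s : ℕ
    s = suc (y + (n ∸ k))
    s+k≡1+y+n : s + k ≡ suc (y + n)
    s+k≡1+y+n = cong suc (trans (+-assoc y (n ∸ k) k) (cong (y +_) (m∸n+n≡m k≤n)))
    y+n<s+k : y + n < s + k
    y+n<s+k = ≤-reflexive (sym s+k≡1+y+n)
    s<n : s < n
    s<n = begin-strict
      suc y + (n ∸ k)   <⟨ +-monoˡ-< (n ∸ k) (≤-<-trans y<x x<k) ⟩
      k + (n ∸ k)       ≡⟨ m+[n∸m]≡n k≤n ⟩
      n                 ∎
      where open ≤-Reasoning
    ¬sx : ¬ InWindow s x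
    ¬sx (inj₁ (s≤x , _)) = <⇒≱ x<k (begin
      k                 ≤⟨ m+n≤o⇒m≤o∸n k k+k≤n ⟩
      n ∸ k             ≤⟨ m≤n+m (n ∸ k) (suc y) ⟩
      s                 ≤⟨ s≤x ⟩
      x                 ∎)
      where open ≤-Reasoning
    ¬sx (inj₂ x+n<s+k) = <⇒≱ y<x (+-cancelʳ-≤ n x y (s≤s⁻¹ (subst (x + n <_) s+k≡1+y+n x+n<s+k)))

  -- The window starting at y or the one ending at y misses x, as 2k ≤ n; the hypothesis
  -- rules out the cases where the only such window is W, the one starting at 0.
  separate : ∀ {x y} → y < n → x ≢ y → (y < k → x < k) → Separator x y
  separate {x} {y} y<n x≢y y<k⇒x<k with <-cmp x y
  ... | tri≈ _ x≡y _ = contradiction x≡y x≢y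
  ... | tri< x<y _ _ with x + n <? y + k
  ...   | no  ¬wrap = separator-starting-at (≤-<-trans z≤n x<y) y<n
                        [ (λ (y≤x , _) → <⇒≱ x<y y≤x) , ¬wrap ]
  ...   | yes wrap  = separator-ending-at k≤y y<n (λ (_ , y<x+k) → <-irrefl refl (begin-strict
      y + k         <⟨ +-monoˡ-< k y<x+k ⟩
      x + k + k     ≡⟨ +-assoc x k k ⟩
      x + (k + k)   ≤⟨ +-monoʳ-≤ x k+k≤n ⟩
      x + n         <⟨ wrap ⟩
      y + k         ∎))
    where
    open ≤-Reasoning
    k≤y : k ≤ y
    k≤y = <⇒≤ (+-cancelʳ-< k k y (≤-<-trans (≤-trans k+k≤n (m≤n+m n x)) wrap))
  separate {x} {y} y<n x≢y y<k⇒x<k | tri> _ _ y<x with x <? y + k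
  ...   | no ¬x<y+k = separator-starting-at (n≢0⇒n>0 y≢0) y<n
                        [ (λ (_ , x<y+k) → ¬x<y+k x<y+k)
                        , (λ x+n<y+k → ¬x<y+k (≤-<-trans (m≤m+n x n) x+n<y+k)) ]
    where
    y≢0 : y ≢ 0
    y≢0 refl = ¬x<y+k (y<k⇒x<k 1≤k)
  ...   | yes x<y+k with k ≤? y
  ...     | yes k≤y = separator-ending-at k≤y y<n (λ (x≤y , _) → <⇒≱ y<x x≤y)
  ...     | no  k≰y = separator-wrapping-to y<x (y<k⇒x<k (≰⇒> k≰y))

  ∈window-zero⁻ : ∀ {x} → x ∈ window zero → toℕ x < k
  ∈window-zero⁻ x∈W with ∈window⁻ x∈W
  ... | inj₁ (_ , x<k) = x<k
  ... | inj₂ x+n<k     = contradiction x+n<k (no-wrap-after z≤n)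

  ∈window-zero⁺ : ∀ {x} → toℕ x < k → x ∈ window zero
  ∈window-zero⁺ x<k = ∈window⁺ (inj₁ (z≤n , x<k))

  windows-separate : ∀ (g h : Fin n) → g ≢ h → (h ∈ window zero → g ∈ window zero) →
                     ∃ λ (c : Fin p) → g ∉ window (suc c) × h ∈ window (suc c)
  windows-separate g h g≢h h∈W⇒g∈W
    with separate (Fin.toℕ<n h) (g≢h ∘ Fin.toℕ-injective) (∈window-zero⁻ ∘ h∈W⇒g∈W ∘ ∈window-zero⁺)
  ... | suc c , _ , s≤s c<p , h-in , g-out =
    fromℕ< c<p , g-out ∘ subst (InWindow-at (toℕ g)) c′≡c ∘ ∈window⁻
               , ∈window⁺ (subst (InWindow-at (toℕ h)) (sym c′≡c) h-in)
    where
    InWindow-at : ℕ → ℕ → Set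
    InWindow-at x t = InWindow (suc t) x
    c′≡c : toℕ (fromℕ< c<p) ≡ c
    c′≡c = Fin.toℕ-fromℕ< c<p

module WindowFamily (p k r : ℕ) (2≤k : 2 ≤ k) (k+k≤n : k + k ≤ suc p)
                    (room : suc p + r ≤ suc p C k) where

  open CyclicWindows p k (≤-trans (s≤s z≤n) 2≤k) k+k≤n
  open Without {A = Subset (suc p)} (Vec.≡-dec Bool._≟_)

  windows : List (Subset (suc p))
  windows = tabulate window

  spares : List (Subset (suc p))
  spares = subsetsOfSize (suc p) k without windows

  spares-unique : Unique spares
  spares-unique = without-unique windows (subsetsOfSize-unique (suc p) k)

  r≤∣spares∣ : r ≤ length spares
  r≤∣spares∣ = +-cancelˡ-≤ (suc p) r (length spares) (begin
    suc p + r                         ≤⟨ room ⟩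
    suc p C k                         ≡⟨ length-subsetsOfSize (suc p) k ⟨
    length (subsetsOfSize (suc p) k)  ≤⟨ length-without windows (subsetsOfSize-unique (suc p) k) ⟩
    length windows + length spares    ≡⟨ cong (_+ length spares) (length-tabulate window) ⟩
    suc p + length spares             ∎)
    where open ≤-Reasoning

  spare : Fin r → Subset (suc p)
  spare i = lookup spares (inject≤ i r≤∣spares∣)

  spare-fresh : ∀ i → spare i ∈ₗ subsetsOfSize (suc p) k × spare i ∉ₗ windows
  spare-fresh i = ∈-without⁻ windows (∈-lookup {xs = spares} (inject≤ i r≤∣spares∣))

  spare≢window : ∀ i s → spare i ≢ window s
  spare≢window i s spare≡window =
    proj₂ (spare-fresh i) (subst (_∈ₗ windows) (sym spare≡window) (∈-tabulate⁺ {f = window} s))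

  spare-injective : ∀ i i′ → spare i ≡ spare i′ → i ≡ i′
  spare-injective i i′ =
    Fin.inject≤-injective _ _ i i′
    ∘ lookup-injective spares-unique (inject≤ i r≤∣spares∣) (inject≤ i′ r≤∣spares∣)

  family : Fin p ⊎ Fin r → Subset (suc p)
  family (inj₁ c) = window (suc c)
  family (inj₂ i) = spare i

  ∣family∣ : ∀ t → ∣ family t ∣ ≡ k
  ∣family∣ (inj₁ c) = ∣window∣ (suc c)
  ∣family∣ (inj₂ i) = All.lookup (subsetsOfSize-size (suc p) k) (proj₁ (spare-fresh i))

  family-injective : ∀ t t′ → family t ≡ family t′ → t ≡ t′
  family-injective (inj₁ c) (inj₁ c′) e =
    cong inj₁ (Fin.suc-injective (window-injective (suc c) (suc c′) e))
  family-injective (inj₁ c) (inj₂ i′) e = contradiction (sym e) (spare≢window i′ (suc c))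
  family-injective (inj₂ i) (inj₁ c′) e = contradiction e (spare≢window i (suc c′))
  family-injective (inj₂ i) (inj₂ i′) e = cong inj₂ (spare-injective i i′ e)

  family≢W : ∀ t → family t ≢ window zero
  family≢W (inj₁ c) e = Fin.0≢1+n (sym (window-injective (suc c) zero e))
  family≢W (inj₂ i)   = spare≢window i zero

  S : Fin (p + r) → Subset (suc p)
  S = family ∘ splitAt p

  S-injective : ∀ {j j′} → S j ≡ S j′ → j ≡ j′
  S-injective {j} {j′} e = begin
    j                          ≡⟨ Fin.join-splitAt p r j ⟨
    join p r (splitAt p j)     ≡⟨ cong (join p r) (family-injective (splitAt p j) (splitAt p j′) e) ⟩
    join p r (splitAt p j′)    ≡⟨ Fin.join-splitAt p r j′ ⟩
    j′                         ∎
    where open ≡-Reasoning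

  S-separating : ∀ g h → g ≢ h → (h ∈ window zero → g ∈ window zero) → ∃ λ j → g ∉ S j × h ∈ S j
  S-separating g h g≢h h∈W⇒g∈W =
    let (c , g∉ , h∈) = windows-separate g h g≢h h∈W⇒g∈W
    in c ↑ˡ r , subst (g ∉_) (sym (S-window c)) g∉ , subst (h ∈_) (sym (S-window c)) h∈
    where
    S-window : ∀ c → S (c ↑ˡ r) ≡ window (suc c)
    S-window c = cong family (Fin.splitAt-↑ˡ p c r)

  K3-orientedDiameter≡2 : OrientedDiameter (K3 3 p (p + r)) 2
  K3-orientedDiameter≡2 =
    OrientationFromFamily.K3-orientedDiameter≡2 (window zero) S
      2≤k (≤-trans (+-monoˡ-≤ k 2≤k) k+k≤n) (∣window∣ zero) (∣family∣ ∘ splitAt p) S-injective (family≢W ∘ splitAt p) S-separating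

half-bounds : ∀ n → 4 ≤ n → 2 ≤ n / 2 × n / 2 + n / 2 ≤ n
half-bounds n 4≤n = /-monoˡ-≤ 2 4≤n , subst (_≤ n) h*2≡h+h (m/n*n≤m n 2)
  where
  h*2≡h+h : n / 2 * 2 ≡ n / 2 + n / 2
  h*2≡h+h = trans (*-comm (n / 2) 2) (cong (n / 2 +_) (+-identityʳ (n / 2)))

≤∸1⇒< : ∀ {m n} → 0 < m → m ≤ n ∸ 1 → m < n
≤∸1⇒< {n = zero}  0<m m≤0 = contradiction m≤0 (<⇒≱ 0<m)
≤∸1⇒< {n = suc n} _   m≤n = s≤s m≤n

theorem5p10 : ∀ (p q : ℕ) → 5 ≤ p → p ≤ q → q ≤ (suc p C (suc p / 2)) ∸ 1 →
    OrientedDiameter (K3 3 p q) 2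
theorem5p10 p q 5≤p p≤q q≤C∸1 with m≤n⇒∃[o]m+o≡n p≤q
... | r , refl = WindowFamily.K3-orientedDiameter≡2 p k r (proj₁ bounds) (proj₂ bounds) room
  where
  k : ℕ
  k = suc p / 2
  bounds : 2 ≤ k × k + k ≤ suc p
  bounds = half-bounds (suc p) (m≤n⇒m≤1+n (≤-trans (n≤1+n 4) 5≤p))
  room : suc p + r ≤ suc p C k
  room = ≤∸1⇒< (≤-trans (s≤s z≤n) (≤-trans 5≤p (m≤m+n p r))) q≤C∸1
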